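{- Let $m\ge2$, $k\ge1$, $D=\{1,-1,\dots,m,-m\}$, and let $\Gamma$ be a finite vertex-transitive graph with vertex set $D\times[k]$ such that $G=\mathrm{Aut}(\Gamma)$ satisfies $X^k\le G\le Y\wr\mathrm{Sym}(k)$ with $X=\{1\}\times\mathrm{Sym}(m)$ and $Y=\langle\tau\rangle\times\mathrm{Sym}(m)$, and such that the pointwise stabiliser in $G$ of $V\Gamma\setminus(D\times\{1\})$ equals $X$ (acting on $D\times\{1\}$). For $1\le j\le k$ let $D_j=D\times\{j\}$; for $\varepsilon\in\{1,-1\}$ let $A_{\varepsilon j}=\{(\varepsilon i,j):1\le i\le m\}$ (these are the orbits of $X^k$). Let $\Sigma$ be the quotient graph $\Gamma/X^k$ with vertex set $\{A_{\pm j}:1\le j\le k\}$, and $\mathcal P=\{\{A_j,A_{ -j}\}:1\le j\le k\}$. Then: (1) for all $j_1,j_2$, $\Gamma[D_{j_1}]\cong\Gamma[D_{j_2}]$, and $\Gamma[D_{j_1}]$ is isomorphic to $mK_2$, $K_m\square K_2$, $\overline{mK_2}$ or $\overline{K_m\square K_2}$; (2) $\Gamma\cong\mathrm{Inf}(\Sigma,\mathcal P,m,\lambda,\kappa)$ where $(\lambda,\kappa)=(1,0)$ if $\Gamma[D_1]\cong mK_2$, $(1,1)$ if $\Gamma[D_1]\cong K_m\square K_2$, $(0,1)$ if $\Gamma[D_1]\cong\overline{mK_2}$, and $(0,0)$ if $\Gamma[D_1]\cong\overline{K_m\square K_2}$; (3) for no $j$ is the transposition $(A_j\ A_{ -j})$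 an automorphism of $\Sigma$ (i.e. $\Sigma$ admits no transposition preserving $\mathcal P$).
   Context: $[k]=\{1,\dots,k\}$. $\mathrm{Sym}(m)$ acts on $D$ by $\varepsilon i\mapsto\varepsilon\sigma(i)$, giving $X=\{1\}\times\mathrm{Sym}(m)$; $\tau:x\mapsto -x$; $Y=\langle\tau\rangle\times\mathrm{Sym}(m)$ is generated by $\tau$ and $X$. $Y\wr\mathrm{Sym}(k)$ acts on $D\times[k]$ by $(\delta,j)^{((y_1,\dots,y_k),h)}=(\delta^{y_j},j^h)$, and $X^k=\{((x_1,\dots,x_k),1):x_j\in X\}$. $\Gamma[S]$ is the induced subgraph on $S$. The quotient $\Gamma/X^k$ has the $X^k$-orbits as vertices, two distinct orbits adjacent iff some vertex of one is adjacent in $\Gamma$ to some vertex of the other. $mK_2$ is a perfect matching on $2m$ vertices, $\square$ Cartesian product, overline complement. For a graph $\Sigma$, a partition $\mathcal P$ of $V\Sigma$ into $2$-sets, $m\ge2$ and $\lambda,\kappa\in\mathbb Z_2$, $\mathrm{Inf}(\Sigma,\mathcal P,m,\lambda,\kappa)$ has vertex set $V\Sigma\times\{1,\dots,m\}$ with $(\alpha,i)\sim(\beta,j)$ iff: $\{\alpha,\beta\}\notin\mathcal P$ and $\alpha\sim\beta$ in $\Sigma$; or $\{\alpha,\beta\}\in\mathcal P$, $\lambda=1$, $i=j$; or $\{\alpha,\beta\}\in\mathcal P$, $\lambda=0$, $i\ne j$; or $\alpha=\beta$ (with $i\neq j$) and $\kappa=1$. -}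

module Defs where

open import Data.Bool using (Bool; true; false; not; _∧_; _∨_; _xor_; if_then_else_)
import Data.Bool.Properties as BoolP
open import Data.Nat using (ℕ; zero; suc; _≤_; _<_)
open import Data.Fin using (Fin; fromℕ<)
import Data.Fin as F
import Data.Fin.Properties as FinP
open import Data.Product using (Σ; _×_; _,_; proj₁; proj₂)
import Data.Product.Properties as ProdP
open import Relation.Binary.PropositionalEquality using (_≡_; _≢_)
open import Relation.Binary.Definitions using (DecidableEquality)
open import Relation.Nullary.Decidable using (⌊_⌋)
open import Function.Definitions using (Bijective)
open import Function using (id)

Graph : Set → Set
Graph V = V → V → Bool

IsSimple : {V : Set} → Graph V → Set
IsSimple Γ = (∀ u v → Γ u v ≡ Γ v u) × (∀ v → Γ v v ≡ false)

IsAut : {V : Set} → Graph V → (V → V) → Set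
IsAut Γ f = Bijective _≡_ _≡_ f × (∀ u v → Γ (f u) (f v) ≡ Γ u v)

_≅_ : {V W : Set} → Graph V → Graph W → Set
_≅_ {V} {W} Γ Δ =
  Σ (V → W) λ f → Bijective _≡_ _≡_ f × (∀ u v → Δ (f u) (f v) ≡ Γ u v)

VertexTransitive : {V : Set} → Graph V → Set
VertexTransitive {V} Γ = ∀ u v → Σ (V → V) λ f → IsAut Γ f × f u ≡ v

induced : {V : Set} → Graph V → (P : V → Set) → Graph (Σ V P)
induced Γ P (u , _) (v , _) = Γ u v

complement : {V : Set} → DecidableEquality V → Graph V → Graph V
complement _≟_ Γ u v = not ⌊ u ≟ v ⌋ ∧ not (Γ u v)

K : (n : ℕ) → Graph (Fin n)
K n i j = not ⌊ i F.≟ j ⌋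

cart : {V W : Set} → DecidableEquality V → DecidableEquality W →
       Graph V → Graph W → Graph (V × W)
cart _≟v_ _≟w_ Γ Δ (v , w) (v' , w') =
  (⌊ v ≟v v' ⌋ ∧ Δ w w') ∨ (⌊ w ≟w w' ⌋ ∧ Γ v v')

mK2 : (m : ℕ) → Graph (Fin m × Fin 2)
mK2 m (i , a) (j , b) = ⌊ i F.≟ j ⌋ ∧ K 2 a b

KmK2 : (m : ℕ) → Graph (Fin m × Fin 2)
KmK2 m = cart F._≟_ F._≟_ (K m) (K 2)

decFin2 : (m : ℕ) → DecidableEquality (Fin m × Fin 2)
decFin2 m = ProdP.≡-dec F._≟_ F._≟_

-- The setting.  A sign ε ∈ {1,-1} is a Bool (true = +1, false = -1);
-- D = {±1,…,±m} is Bool × Fin m, with (ε , i) standing for ε·(i+1);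
-- [k] is Fin k (index 0 stands for 1).

D : ℕ → Set
D m = Bool × Fin m

Vtx : ℕ → ℕ → Set
Vtx m k = D m × Fin k

decD : (m : ℕ) → DecidableEquality (D m)
decD m = ProdP.≡-dec BoolP._≟_ F._≟_

one : (k : ℕ) → 1 ≤ k → Fin k
one k p = fromℕ< p

-- action of the element τ^t σ of Y = ⟨τ⟩ × Sym(m) on D : εi ↦ (±ε)σ(i)
actY : {m : ℕ} → Bool → (Fin m → Fin m) → D m → D m
actY t σ (ε , i) = (ε xor t , σ i)

-- action of ((y_1,…,y_k),h) ∈ Y ≀ Sym(k), y_j = τ^{t j} σ_j, on D × [k]
wr : {m k : ℕ} → (Fin k → Bool) → (Fin k → Fin m → Fin m) → (Fin k → Fin k) →
     Vtx m k → Vtx m k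
wr t σ h (δ , j) = (actY (t j) (σ j) δ , h j)

XkInAut : {m k : ℕ} → Graph (Vtx m k) → Set
XkInAut {m} {k} Γ = (σ : Fin k → Fin m → Fin m) →
  (∀ j → Bijective _≡_ _≡_ (σ j)) → IsAut Γ (wr (λ _ → false) σ id)

AutInYwr : {m k : ℕ} → Graph (Vtx m k) → Set
AutInYwr {m} {k} Γ = (f : Vtx m k → Vtx m k) → IsAut Γ f →
  Σ (Fin k → Bool) λ t → Σ (Fin k → Fin m → Fin m) λ σ → Σ (Fin k → Fin k) λ h →
    (∀ j → Bijective _≡_ _≡_ (σ j)) × Bijective _≡_ _≡_ h ×
    (∀ v → f v ≡ wr t σ h v)

xOn : {m k : ℕ} → Fin k → (Fin m → Fin m) → Vtx m k → Vtx m k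
xOn j₁ σ (δ , j) = if ⌊ j F.≟ j₁ ⌋ then (actY false σ δ , j) else (δ , j)

StabIsX : {m k : ℕ} → Graph (Vtx m k) → Fin k → Set
StabIsX {m} {k} Γ j₁ = (f : Vtx m k → Vtx m k) →
  ((IsAut Γ f × (∀ v → proj₂ v ≢ j₁ → f v ≡ v)) →
     Σ (Fin m → Fin m) λ σ → Bijective _≡_ _≡_ σ × (∀ v → f v ≡ xOn j₁ σ v))
  × ((Σ (Fin m → Fin m) λ σ → Bijective _≡_ _≡_ σ × (∀ v → f v ≡ xOn j₁ σ v)) →
     (IsAut Γ f × (∀ v → proj₂ v ≢ j₁ → f v ≡ v)))

InD : {m k : ℕ} → Fin k → Vtx m k → Set
InD j v = proj₂ v ≡ j

-- Quotient Γ / X^k.  Its vertices are the X^k-orbits A_{εj} = {(εi , j) : i},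
-- indexed by (ε , j) ∈ Bool × Fin k.

anyFin : {n : ℕ} → (Fin n → Bool) → Bool
anyFin {zero} p = false
anyFin {suc n} p = p F.zero ∨ anyFin (λ i → p (F.suc i))

Orb : ℕ → Set
Orb k = Bool × Fin k

decOrb : (k : ℕ) → DecidableEquality (Orb k)
decOrb k = ProdP.≡-dec BoolP._≟_ F._≟_

quot : {m k : ℕ} → Graph (Vtx m k) → Graph (Orb k)
quot {m} {k} Γ (ε , j) (ε' , j') =
  not ⌊ decOrb k (ε , j) (ε' , j') ⌋ ∧
  anyFin (λ i → anyFin (λ i' → Γ ((ε , i) , j) ((ε' , i') , j')))

-- the partition 𝒫 = {{A_j , A_{-j}}} : pairInP a b holds iff {a , b} ∈ 𝒫
pairInP : {k : ℕ} → Orb k → Orb k → Bool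
pairInP (ε , j) (ε' , j') = ⌊ j F.≟ j' ⌋ ∧ (ε xor ε')

-- Inf(Σ, 𝒫, m, λ, κ), with 𝒫 given by its "is a block" relation inP,
-- and λ, κ ∈ ℤ₂ represented by Bool (true = 1).

Inf : {W : Set} → DecidableEquality W → Graph W → (inP : W → W → Bool) →
      (m : ℕ) → Bool → Bool → Graph (W × Fin m)
Inf _≟_ Σg inP m λ' κ (α , i) (β , j) =
     (not (inP α β) ∧ Σg α β)
  ∨ (inP α β ∧ λ' ∧ ⌊ i F.≟ j ⌋)
  ∨ (inP α β ∧ not λ' ∧ not ⌊ i F.≟ j ⌋)
  ∨ (⌊ α ≟ β ⌋ ∧ not ⌊ i F.≟ j ⌋ ∧ κ)

swapAt : {k : ℕ} → Fin k → Orb k → Orb k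
swapAt j (ε , j') = if ⌊ j F.≟ j' ⌋ then (not ε , j') else (ε , j')

-- The subgroup Xᵏ makes adjacency inside a block D_j depend only on whether two vertices have
-- the same sign and the same index, and adjacency between two blocks depend only on the signs.
-- A vertex-transitive group inside Y ≀ Sym(k) maps D_1 onto every D_j up to a global sign change,
-- so the three values inside a block, κ (same sign), λ (opposite signs, same index) and
-- μ (opposite signs, different indices), are the same for all blocks.  If μ = λ, permuting the
-- half A_1 of D_1 alone would be an automorphism fixing VΓ ∖ D_1 that is not in X; hence
-- μ = not λ, every Γ[D_j] is the block graph of Inf(Σ, 𝒫, m, λ, κ), and Γ ≅ Inf(Σ, 𝒫, m, λ, κ).
-- This gives (1) and (2), as (λ, κ) is read off Γ[D_1] up to isomorphism except that λ is
-- irrelevant when m = 2.  For (3), a transposition (A_j A_{-j}) preserving Σ lifts to an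
-- automorphism of Γ ≅ Inf changing the signs inside D_j; conjugated into D_1 it contradicts
-- the stabiliser being X.

module Submission where

open import Defs
open import Data.Bool using (Bool; true; false; not; _∧_; _∨_; _xor_; if_then_else_)
open import Data.Bool.Properties
  using (∨-identityʳ; ∨-idem; ∧-identityʳ; ∧-zeroʳ; not-involutive; ¬-not; not-¬;
         xor-identityʳ; xor-assoc; xor-annihilates-not)
  renaming (_≟_ to _≟ᵇ_)
open import Data.Nat using (ℕ; zero; suc; _+_; _≤_; s≤s; z≤n)
open import Data.Fin using (Fin; zero; suc; opposite)
open import Data.Fin.Properties using (_≟_; 0≢1+n; opposite-involutive)
open import Data.Fin.Permutation using (Permutation′; _⟨$⟩ʳ_; transpose; _∘ₚ_)
import Data.Fin.Permutation as Perm
open import Data.Product using (Σ; _×_; _,_; proj₁; proj₂; map₁)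
open import Data.Product.Properties using (×-≡,≡→≡; ×-≡,≡←≡)
open import Data.Sum using (_⊎_; inj₁; inj₂)
open import Data.Empty using (⊥-elim)
open import Function using (_∘_; id)
open import Function.Bundles using (Inverse; Bijection; mk⤖; mk↔ₛ′; _⇔_; mk⇔)
open import Function.Definitions using (Bijective; Injective)
open import Function.Properties.Bijection using (⤖⇒↔)
open import Function.Properties.Inverse using (↔⇒⤖)
open import Function.Construct.Composition using () renaming (bijective to ∘-bijective)
open import Relation.Binary.Definitions using (DecidableEquality)
open import Relation.Binary.PropositionalEquality
open import Relation.Nullary using (¬_; Dec; yes; no)
open import Relation.Nullary.Decidable using (⌊_⌋; isYes≗does; dec-true; dec-false; does-⇔; _×-dec_)

module _ {a} {A : Set a} where

  ⌊⌋-yes : (a? : Dec A) → A → ⌊ a? ⌋ ≡ true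
  ⌊⌋-yes a? x = trans (isYes≗does a?) (dec-true a? x)

  ⌊⌋-no : (a? : Dec A) → ¬ A → ⌊ a? ⌋ ≡ false
  ⌊⌋-no a? ¬x = trans (isYes≗does a?) (dec-false a? ¬x)

  ⌊⌋-⇔ : ∀ {b} {B : Set b} → A ⇔ B → (a? : Dec A) (b? : Dec B) → ⌊ a? ⌋ ≡ ⌊ b? ⌋
  ⌊⌋-⇔ A⇔B a? b? = trans (isYes≗does a?) (trans (does-⇔ A⇔B a? b?) (sym (isYes≗does b?)))

⌊≟⌋-injective : ∀ {A B : Set} (_≟A_ : DecidableEquality A) (_≟B_ : DecidableEquality B)
  {f : A → B} → Injective _≡_ _≡_ f → ∀ x y → ⌊ f x ≟B f y ⌋ ≡ ⌊ x ≟A y ⌋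
⌊≟⌋-injective _≟A_ _≟B_ {f} f-inj x y = ⌊⌋-⇔ (mk⇔ f-inj (cong f)) (f x ≟B f y) (x ≟A y)

⌊≟⌋-× : ∀ {A B : Set} (_≟A_ : DecidableEquality A) (_≟B_ : DecidableEquality B)
  (_≟_ : DecidableEquality (A × B)) (x x' : A) (y y' : B) →
  ⌊ (x , y) ≟ (x' , y') ⌋ ≡ ⌊ x ≟A x' ⌋ ∧ ⌊ y ≟B y' ⌋
⌊≟⌋-× _≟A_ _≟B_ _≟_ x x' y y' =
  trans (isYes≗does ((x , y) ≟ (x' , y')))
    (trans (does-⇔ (mk⇔ ×-≡,≡←≡ ×-≡,≡→≡) ((x , y) ≟ (x' , y')) ((x ≟A x') ×-dec (y ≟B y')))
           (sym (cong₂ _∧_ (isYes≗does (x ≟A x')) (isYes≗does (y ≟B y')))))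

inverse⇒bijective : ∀ {A B : Set} {f : A → B} (g : B → A) →
  (∀ y → f (g y) ≡ y) → (∀ x → g (f x) ≡ x) → Bijective _≡_ _≡_ f
inverse⇒bijective g fg gf = Bijection.bijective (↔⇒⤖ (mk↔ₛ′ _ g fg gf))

mk≅ : {U V : Set} {A : Graph U} {B : Graph V} (f : U → V) (g : V → U) →
      (∀ y → f (g y) ≡ y) → (∀ x → g (f x) ≡ x) → (∀ u v → B (f u) (f v) ≡ A u v) → A ≅ B
mk≅ f g fg gf pres = f , inverse⇒bijective g fg gf , pres

≅-refl : {U : Set} {A : Graph U} → A ≅ A
≅-refl = mk≅ id id (λ _ → refl) (λ _ → refl) (λ _ _ → refl)

≅-sym : {U V : Set} {A : Graph U} {B : Graph V} → A ≅ B → B ≅ A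
≅-sym {A = A} {B} (f , f-bij , pres) =
  mk≅ {A = B} {B = A} from f strictlyInverseʳ strictlyInverseˡ λ u v →
    trans (sym (pres (from u) (from v))) (cong₂ B (strictlyInverseˡ u) (strictlyInverseˡ v))
  where open Inverse (⤖⇒↔ (mk⤖ f-bij))

≅-trans : {U V W : Set} {A : Graph U} {B : Graph V} {C : Graph W} → A ≅ B → B ≅ C → A ≅ C
≅-trans (f , f-bij , f-pres) (g , g-bij , g-pres) =
  g ∘ f , ∘-bijective _≡_ _≡_ _≡_ f-bij g-bij , λ u v → trans (g-pres (f u) (f v)) (f-pres u v)

≅-respʳ : {U V : Set} {A : Graph U} {B B' : Graph V} → (∀ u v → B u v ≡ B' u v) → A ≅ B → A ≅ B'
≅-respʳ B≗B' (f , f-bij , pres) = f , f-bij , λ u v → trans (sym (B≗B' (f u) (f v))) (pres u v)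

HasTriangle : {V : Set} → Graph V → Set
HasTriangle {V} G = Σ V λ u → Σ V λ v → Σ V λ w →
  G u v ≡ true × G v w ≡ true × G u w ≡ true

HasTwoNeighbours : {V : Set} → Graph V → Set
HasTwoNeighbours {V} G = Σ V λ u → Σ V λ v → Σ V λ w →
  G u v ≡ true × G u w ≡ true × v ≢ w

HasEdgeWithoutCommonNeighbour : {V : Set} → Graph V → Set
HasEdgeWithoutCommonNeighbour {V} G = Σ V λ u → Σ V λ v →
  G u v ≡ true × (∀ w → G u w ∧ G v w ≡ false)

module _ {U V : Set} {A : Graph U} {B : Graph V} (A≅B : A ≅ B) where
  private
    f = proj₁ A≅B
    f-injective = proj₁ (proj₁ (proj₂ A≅B))
    pres = proj₂ (proj₂ A≅B)
    open Inverse (⤖⇒↔ (mk⤖ (proj₁ (proj₂ A≅B)))) using (from; strictlyInverseˡ)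

  ≅-HasTriangle : HasTriangle A → HasTriangle B
  ≅-HasTriangle (u , v , w , uv , vw , uw) =
    f u , f v , f w , trans (pres u v) uv , trans (pres v w) vw , trans (pres u w) uw

  ≅-HasTwoNeighbours : HasTwoNeighbours A → HasTwoNeighbours B
  ≅-HasTwoNeighbours (u , v , w , uv , uw , v≢w) =
    f u , f v , f w , trans (pres u v) uv , trans (pres u w) uw , v≢w ∘ f-injective

  ≅-HasEdgeWithoutCommonNeighbour : HasEdgeWithoutCommonNeighbour A → HasEdgeWithoutCommonNeighbour B
  ≅-HasEdgeWithoutCommonNeighbour (u , v , uv , lonely) = f u , f v , trans (pres u v) uv , λ w →
    subst (λ w' → B (f u) w' ∧ B (f v) w' ≡ false) (strictlyInverseˡ w)
      (trans (cong₂ _∧_ (pres u (from w)) (pres v (from w))) (lonely (from w)))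

-- Block graphs

-- Inf(Σ, 𝒫, m, λ', κ) restricted to a block {A_j , A_{-j}} of 𝒫: side 0 is A_j, side 1 is A_{-j}.
Block : (m : ℕ) → Bool → Bool → Graph (Fin m × Fin 2)
Block m λ' κ (i , a) (i' , a') =
  if ⌊ a ≟ a' ⌋ then not ⌊ i ≟ i' ⌋ ∧ κ else (λ' ∧ ⌊ i ≟ i' ⌋ ∨ not λ' ∧ not ⌊ i ≟ i' ⌋)

Block-mK2 : ∀ m u v → mK2 m u v ≡ Block m true false u v
Block-mK2 m (i , a) (i' , a') with i ≟ i' | a ≟ a'
... | yes _ | yes _ = refl
... | yes _ | no _ = refl
... | no _ | yes _ = refl
... | no _ | no _ = refl

Block-KmK2 : ∀ m u v → KmK2 m u v ≡ Block m true true u v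
Block-KmK2 m (i , a) (i' , a') with i ≟ i' | a ≟ a'
... | yes _ | yes _ = refl
... | yes _ | no _ = refl
... | no _ | yes _ = refl
... | no _ | no _ = refl

Block-complement : ∀ m λ' κ u v →
  complement (decFin2 m) (Block m λ' κ) u v ≡ Block m (not λ') (not κ) u v
Block-complement m λ' κ (i , a) (i' , a')
  rewrite ⌊≟⌋-× _≟_ _≟_ (decFin2 m) i i' a a' with i ≟ i' | a ≟ a' | λ'
... | yes _ | yes _ | _ = refl
... | no _ | yes _ | _ = refl
... | yes _ | no _ | true = refl
... | yes _ | no _ | false = refl
... | no _ | no _ | true = refl
... | no _ | no _ | false = refl

complement-resp : ∀ {V} (_≟V_ : DecidableEquality V) {G H : Graph V} →
  (∀ u v → G u v ≡ H u v) → ∀ u v → complement _≟V_ G u v ≡ complement _≟V_ H u v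
complement-resp _≟V_ G≗H u v = cong (λ b → not ⌊ u ≟V v ⌋ ∧ not b) (G≗H u v)

Block-co-mK2 : ∀ m u v → complement (decFin2 m) (mK2 m) u v ≡ Block m false true u v
Block-co-mK2 m u v = trans (complement-resp (decFin2 m) (Block-mK2 m) u v) (Block-complement m true false u v)

Block-co-KmK2 : ∀ m u v → complement (decFin2 m) (KmK2 m) u v ≡ Block m false false u v
Block-co-KmK2 m u v = trans (complement-resp (decFin2 m) (Block-KmK2 m) u v) (Block-complement m true true u v)

Block-classification : ∀ {V : Set} {A : Graph V} m λ' κ → A ≅ Block m λ' κ →
  (A ≅ mK2 m) ⊎ (A ≅ KmK2 m) ⊎ (A ≅ complement (decFin2 m) (mK2 m)) ⊎ (A ≅ complement (decFin2 m) (KmK2 m))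
Block-classification m true false iso = inj₁ (≅-respʳ (λ u v → sym (Block-mK2 m u v)) iso)
Block-classification m true true iso = inj₂ (inj₁ (≅-respʳ (λ u v → sym (Block-KmK2 m u v)) iso))
Block-classification m false true iso = inj₂ (inj₂ (inj₁ (≅-respʳ (λ u v → sym (Block-co-mK2 m u v)) iso)))
Block-classification m false false iso = inj₂ (inj₂ (inj₂ (≅-respʳ (λ u v → sym (Block-co-KmK2 m u v)) iso)))

Fin2-≢-≢ : {a b c : Fin 2} → a ≢ b → a ≢ c → b ≡ c
Fin2-≢-≢ {zero} {zero} a≢b _ = ⊥-elim (a≢b refl)
Fin2-≢-≢ {zero} {suc zero} {zero} _ a≢c = ⊥-elim (a≢c refl)
Fin2-≢-≢ {zero} {suc zero} {suc zero} _ _ = refl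
Fin2-≢-≢ {suc zero} {zero} {zero} _ _ = refl
Fin2-≢-≢ {suc zero} {zero} {suc zero} _ a≢c = ⊥-elim (a≢c refl)
Fin2-≢-≢ {suc zero} {suc zero} a≢b _ = ⊥-elim (a≢b refl)

Block-false-adjacent : ∀ {m} λ' i a i' a' → Block m λ' false (i , a) (i' , a') ≡ true →
  a ≢ a' × ⌊ i ≟ i' ⌋ ≡ λ'
Block-false-adjacent λ' i a i' a' adj with a ≟ a' | i ≟ i' | λ' | adj
... | yes _ | yes _ | _ | ()
... | yes _ | no _ | _ | ()
... | no a≢a' | yes _ | true | _ = a≢a' , refl
... | no a≢a' | no _ | false | _ = a≢a' , refl

Block-false-¬HasTriangle : ∀ {m} λ' → ¬ HasTriangle (Block m λ' false)
Block-false-¬HasTriangle λ' ((i , a) , (i' , b) , (i'' , c) , uv , vw , uw) =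
  proj₁ (Block-false-adjacent λ' i' b i'' c vw)
    (Fin2-≢-≢ (proj₁ (Block-false-adjacent λ' i a i' b uv)) (proj₁ (Block-false-adjacent λ' i a i'' c uw)))

Block-false-¬HasTwoNeighbours : ∀ {m} λ' →
  (∀ (i i₁ i₂ : Fin m) → ⌊ i ≟ i₁ ⌋ ≡ λ' → ⌊ i ≟ i₂ ⌋ ≡ λ' → i₁ ≡ i₂) →
  ¬ HasTwoNeighbours (Block m λ' false)
Block-false-¬HasTwoNeighbours λ' determined ((i , a) , (i₁ , b) , (i₂ , c) , uv , uw , v≢w)
  with Block-false-adjacent λ' i a i₁ b uv | Block-false-adjacent λ' i a i₂ c uw
... | a≢b , i~i₁ | a≢c , i~i₂ = v≢w (cong₂ _,_ (determined i i₁ i₂ i~i₁ i~i₂) (Fin2-≢-≢ a≢b a≢c))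

equal-index-determined : ∀ {m} (i i₁ i₂ : Fin m) →
  ⌊ i ≟ i₁ ⌋ ≡ true → ⌊ i ≟ i₂ ⌋ ≡ true → i₁ ≡ i₂
equal-index-determined i i₁ i₂ e₁ e₂ with i ≟ i₁ | i ≟ i₂ | e₁ | e₂
... | yes refl | yes refl | _ | _ = refl

Fin2-index-determined : ∀ λ' (i i₁ i₂ : Fin 2) →
  ⌊ i ≟ i₁ ⌋ ≡ λ' → ⌊ i ≟ i₂ ⌋ ≡ λ' → i₁ ≡ i₂
Fin2-index-determined λ' i i₁ i₂ e₁ e₂ with i ≟ i₁ | i ≟ i₂
... | yes refl | yes refl = refl
... | no i≢i₁ | no i≢i₂ = Fin2-≢-≢ i≢i₁ i≢i₂
... | yes _ | no _ with () ← trans e₁ (sym e₂)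
... | no _ | yes _ with () ← trans e₁ (sym e₂)

Block-false-true-adjacency : ∀ {m} i a i' a' → Block m false true (i , a) (i' , a') ≡ not ⌊ i ≟ i' ⌋
Block-false-true-adjacency i a i' a' with a ≟ a' | i ≟ i'
... | yes _ | yes _ = refl
... | yes _ | no _ = refl
... | no _ | yes _ = refl
... | no _ | no _ = refl

third-index : ∀ {n} (i i' : Fin (3 + n)) → Σ (Fin (3 + n)) λ l → i ≢ l × i' ≢ l
third-index zero zero = suc zero , (λ ()) , (λ ())
third-index zero (suc zero) = suc (suc zero) , (λ ()) , (λ ())
third-index zero (suc (suc _)) = suc zero , (λ ()) , (λ ())
third-index (suc zero) zero = suc (suc zero) , (λ ()) , (λ ())
third-index (suc zero) (suc _) = zero , (λ ()) , (λ ())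
third-index (suc (suc _)) zero = suc zero , (λ ()) , (λ ())
third-index (suc (suc _)) (suc _) = zero , (λ ()) , (λ ())

Block-false-true-¬HasEdgeWithoutCommonNeighbour : ∀ n →
  ¬ HasEdgeWithoutCommonNeighbour (Block (3 + n) false true)
Block-false-true-¬HasEdgeWithoutCommonNeighbour n ((i , a) , (i' , a') , _ , lonely)
  with third-index i i'
... | l , i≢l , i'≢l with () ← trans (sym (lonely (l , zero)))
        (cong₂ _∧_ (trans (Block-false-true-adjacency i a l zero) (cong not (⌊⌋-no (i ≟ l) i≢l)))
                   (trans (Block-false-true-adjacency i' a' l zero) (cong not (⌊⌋-no (i' ≟ l) i'≢l))))

Block-true-HasTwoNeighbours : ∀ n λ' → HasTwoNeighbours (Block (2 + n) λ' true)
Block-true-HasTwoNeighbours n true = (zero , zero) , (suc zero , zero) , (zero , suc zero) , refl , refl , λ ()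
Block-true-HasTwoNeighbours n false = (zero , zero) , (suc zero , zero) , (suc zero , suc zero) , refl , refl , λ ()

Block-true-HasTriangle : ∀ n λ' → HasTriangle (Block (3 + n) λ' true)
Block-true-HasTriangle n λ' = (zero , zero) , (suc zero , zero) , (suc (suc zero) , zero) , refl , refl , refl

Block-false-false-HasTwoNeighbours : ∀ n → HasTwoNeighbours (Block (3 + n) false false)
Block-false-false-HasTwoNeighbours n =
  (zero , zero) , (suc zero , suc zero) , (suc (suc zero) , suc zero) , refl , refl , λ ()

Block-true-true-HasEdgeWithoutCommonNeighbour : ∀ n → HasEdgeWithoutCommonNeighbour (Block (2 + n) true true)
Block-true-true-HasEdgeWithoutCommonNeighbour n = (zero , zero) , (zero , suc zero) , refl , λ where
  (zero , zero) → refl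
  (zero , suc zero) → refl
  (suc _ , zero) → refl
  (suc _ , suc zero) → refl

Block-true≇Block-false : ∀ n λ₁ λ₂ → ¬ (Block (2 + n) λ₁ true ≅ Block (2 + n) λ₂ false)
Block-true≇Block-false zero λ₁ λ₂ iso =
  Block-false-¬HasTwoNeighbours λ₂ (Fin2-index-determined λ₂)
    (≅-HasTwoNeighbours iso (Block-true-HasTwoNeighbours zero λ₁))
Block-true≇Block-false (suc n) λ₁ λ₂ iso =
  Block-false-¬HasTriangle λ₂ (≅-HasTriangle iso (Block-true-HasTriangle n λ₁))

Block-true≇Block-false-λ : ∀ n κ → ¬ (Block (3 + n) true κ ≅ Block (3 + n) false κ)
Block-true≇Block-false-λ n true iso =
  Block-false-true-¬HasEdgeWithoutCommonNeighbour n
    (≅-HasEdgeWithoutCommonNeighbour iso (Block-true-true-HasEdgeWithoutCommonNeighbour (suc n)))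
Block-true≇Block-false-λ n false iso =
  Block-false-¬HasTwoNeighbours true equal-index-determined
    (≅-HasTwoNeighbours (≅-sym {A = Block (3 + n) true false} {B = Block (3 + n) false false} iso)
      (Block-false-false-HasTwoNeighbours n))

Block-≅⇒κ≡ : ∀ n λ₁ κ₁ λ₂ κ₂ → Block (2 + n) λ₁ κ₁ ≅ Block (2 + n) λ₂ κ₂ → κ₁ ≡ κ₂
Block-≅⇒κ≡ n λ₁ true λ₂ true _ = refl
Block-≅⇒κ≡ n λ₁ false λ₂ false _ = refl
Block-≅⇒κ≡ n λ₁ true λ₂ false iso = ⊥-elim (Block-true≇Block-false n λ₁ λ₂ iso)
Block-≅⇒κ≡ n λ₁ false λ₂ true iso =
  ⊥-elim (Block-true≇Block-false n λ₂ λ₁ (≅-sym {A = Block (2 + n) λ₁ false} {B = Block (2 + n) λ₂ true} iso))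

Block-≅⇒λ≡ : ∀ n λ₁ λ₂ κ → Block (3 + n) λ₁ κ ≅ Block (3 + n) λ₂ κ → λ₁ ≡ λ₂
Block-≅⇒λ≡ n true true κ _ = refl
Block-≅⇒λ≡ n false false κ _ = refl
Block-≅⇒λ≡ n true false κ iso = ⊥-elim (Block-true≇Block-false-λ n κ iso)
Block-≅⇒λ≡ n false true κ iso =
  ⊥-elim (Block-true≇Block-false-λ n κ (≅-sym {A = Block (3 + n) false κ} {B = Block (3 + n) true κ} iso))

cross-side-equal : ∀ λ' → λ' ∧ true ∨ not λ' ∧ false ≡ λ'
cross-side-equal true = refl
cross-side-equal false = refl

cross-side-distinct : ∀ λ' → λ' ∧ false ∨ not λ' ∧ true ≡ not λ'
cross-side-distinct true = refl
cross-side-distinct false = refl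

-- The graph Inf(Σ, 𝒫, m, λ, κ)

side : Bool → Fin 2
side true = zero
side false = suc zero

⌊opposite≟opposite⌋ : ∀ (i i' : Fin 2) → ⌊ opposite i ≟ opposite i' ⌋ ≡ ⌊ i ≟ i' ⌋
⌊opposite≟opposite⌋ zero zero = refl
⌊opposite≟opposite⌋ zero (suc zero) = refl
⌊opposite≟opposite⌋ (suc zero) zero = refl
⌊opposite≟opposite⌋ (suc zero) (suc zero) = refl

⌊≟opposite⌋ : ∀ (i i' : Fin 2) → ⌊ i ≟ opposite i' ⌋ ≡ not ⌊ i ≟ i' ⌋
⌊≟opposite⌋ zero zero = refl
⌊≟opposite⌋ zero (suc zero) = refl
⌊≟opposite⌋ (suc zero) zero = refl
⌊≟opposite⌋ (suc zero) (suc zero) = refl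

⌊opposite≟⌋ : ∀ (i i' : Fin 2) → ⌊ opposite i ≟ i' ⌋ ≡ not ⌊ i ≟ i' ⌋
⌊opposite≟⌋ zero zero = refl
⌊opposite≟⌋ zero (suc zero) = refl
⌊opposite≟⌋ (suc zero) zero = refl
⌊opposite≟⌋ (suc zero) (suc zero) = refl

swap-cross-disjuncts : ∀ b s λ' d →
  (not b ∧ s) ∨ (b ∧ not λ' ∧ not d) ∨ (b ∧ not (not λ') ∧ not (not d)) ∨ false ≡
  (not b ∧ s) ∨ (b ∧ λ' ∧ d) ∨ (b ∧ not λ' ∧ not d) ∨ false
swap-cross-disjuncts false s λ' d = refl
swap-cross-disjuncts true s true true = refl
swap-cross-disjuncts true s true false = refl
swap-cross-disjuncts true s false true = refl
swap-cross-disjuncts true s false false = refl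

module _ {k : ℕ} (Σg : Graph (Orb k)) where

  Inf-between-blocks : ∀ m λ' κ {j j'} e i e' i' → j ≢ j' →
    Inf (decOrb k) Σg pairInP m λ' κ ((e , j) , i) ((e' , j') , i') ≡ Σg (e , j) (e' , j')
  Inf-between-blocks m λ' κ {j} {j'} e i e' i' j≢j'
    rewrite ⌊⌋-no (j ≟ j') j≢j' | ⌊⌋-no (decOrb k (e , j) (e' , j')) (j≢j' ∘ cong proj₂) =
    ∨-identityʳ _

  Inf-within-block : ∀ m λ' κ → (∀ α → Σg α α ≡ false) → ∀ j e i e' i' →
    Inf (decOrb k) Σg pairInP m λ' κ ((e , j) , i) ((e' , j) , i') ≡ Block m λ' κ (i , side e) (i' , side e')
  Inf-within-block m λ' κ loopless j e i e' i' = within e e'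
    where
    within : ∀ e e' → Inf (decOrb k) Σg pairInP m λ' κ ((e , j) , i) ((e' , j) , i') ≡
                      Block m λ' κ (i , side e) (i' , side e')
    within true true
      rewrite ⌊⌋-yes (j ≟ j) refl | loopless (true , j) | ⌊⌋-yes (decOrb k (true , j) (true , j)) refl = refl
    within false false
      rewrite ⌊⌋-yes (j ≟ j) refl | loopless (false , j) | ⌊⌋-yes (decOrb k (false , j) (false , j)) refl = refl
    within true false
      rewrite ⌊⌋-yes (j ≟ j) refl | ⌊⌋-no (decOrb k (true , j) (false , j)) (λ ()) =
      cong (λ' ∧ ⌊ i ≟ i' ⌋ ∨_) (∨-identityʳ (not λ' ∧ not ⌊ i ≟ i' ⌋))
    within false true
      rewrite ⌊⌋-yes (j ≟ j) refl | ⌊⌋-no (decOrb k (false , j) (true , j)) (λ ()) =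
      cong (λ' ∧ ⌊ i ≟ i' ⌋ ∨_) (∨-identityʳ (not λ' ∧ not ⌊ i ≟ i' ⌋))

  Inf-flip-λ : ∀ λ' κ → Inf (decOrb k) Σg pairInP 2 λ' κ ≅ Inf (decOrb k) Σg pairInP 2 (not λ') κ
  Inf-flip-λ λ' κ = mk≅ {B = Inf (decOrb k) Σg pairInP 2 (not λ') κ} ψ ψ ψ-involutive ψ-involutive pres
    where
    ψ : Orb k × Fin 2 → Orb k × Fin 2
    ψ ((true , j) , i) = (true , j) , i
    ψ ((false , j) , i) = (false , j) , opposite i

    ψ-involutive : ∀ x → ψ (ψ x) ≡ x
    ψ-involutive ((true , j) , i) = refl
    ψ-involutive ((false , j) , i) = cong ((false , j) ,_) (opposite-involutive i)

    pres : ∀ u v → Inf (decOrb k) Σg pairInP 2 (not λ') κ (ψ u) (ψ v) ≡ Inf (decOrb k) Σg pairInP 2 λ' κ u v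
    pres ((true , j) , i) ((true , j') , i') rewrite ∧-zeroʳ ⌊ j ≟ j' ⌋ = refl
    pres ((false , j) , i) ((false , j') , i')
      rewrite ∧-zeroʳ ⌊ j ≟ j' ⌋ | ⌊opposite≟opposite⌋ i i' = refl
    pres ((true , j) , i) ((false , j') , i')
      rewrite ∧-identityʳ ⌊ j ≟ j' ⌋ | ⌊≟opposite⌋ i i' | ⌊⌋-no (decOrb k (true , j) (false , j')) (λ ())
      = swap-cross-disjuncts ⌊ j ≟ j' ⌋ _ λ' ⌊ i ≟ i' ⌋
    pres ((false , j) , i) ((true , j') , i')
      rewrite ∧-identityʳ ⌊ j ≟ j' ⌋ | ⌊opposite≟⌋ i i' | ⌊⌋-no (decOrb k (false , j) (true , j')) (λ ())
      = swap-cross-disjuncts ⌊ j ≟ j' ⌋ _ λ' ⌊ i ≟ i' ⌋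

  -- For m = 2 the block graph does not determine λ, but then neither does Inf up to isomorphism.
  Block-≅⇒Inf-≅ : ∀ n λ₁ κ₁ λ₂ κ₂ → Block (2 + n) λ₁ κ₁ ≅ Block (2 + n) λ₂ κ₂ →
    Inf (decOrb k) Σg pairInP (2 + n) λ₁ κ₁ ≅ Inf (decOrb k) Σg pairInP (2 + n) λ₂ κ₂
  Block-≅⇒Inf-≅ n λ₁ κ₁ λ₂ κ₂ iso with Block-≅⇒κ≡ n λ₁ κ₁ λ₂ κ₂ iso
  Block-≅⇒Inf-≅ zero true κ true .κ iso | refl = ≅-refl
  Block-≅⇒Inf-≅ zero false κ false .κ iso | refl = ≅-refl
  Block-≅⇒Inf-≅ zero true κ false .κ iso | refl = Inf-flip-λ true κ
  Block-≅⇒Inf-≅ zero false κ true .κ iso | refl = Inf-flip-λ false κ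
  Block-≅⇒Inf-≅ (suc n) λ₁ κ λ₂ .κ iso | refl with Block-≅⇒λ≡ n λ₁ λ₂ κ iso
  ... | refl = ≅-refl

Inf-lift : ∀ {W : Set} (_≟W_ : DecidableEquality W) (Σg : Graph W) (inP : W → W → Bool) m λ' κ
  (s : W → W) → Injective _≡_ _≡_ s → (∀ α β → inP (s α) (s β) ≡ inP α β) →
  (∀ α β → Σg (s α) (s β) ≡ Σg α β) →
  ∀ u v → Inf _≟W_ Σg inP m λ' κ (map₁ s u) (map₁ s v) ≡ Inf _≟W_ Σg inP m λ' κ u v
Inf-lift _≟W_ Σg inP m λ' κ s s-injective s-inP s-Σg (α , i) (β , i')
  rewrite s-inP α β | s-Σg α β | ⌊≟⌋-injective _≟W_ _≟W_ s-injective α β = refl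

swapAt-involutive : ∀ {k} (j : Fin k) α → swapAt j (swapAt j α) ≡ α
swapAt-involutive j (e , j') with j ≟ j'
... | yes j≡j' rewrite ⌊⌋-yes (j ≟ j') j≡j' = cong (_, j') (not-involutive e)
... | no j≢j' rewrite ⌊⌋-no (j ≟ j') j≢j' = refl

pairInP-swapAt : ∀ {k} (j : Fin k) α β → pairInP (swapAt j α) (swapAt j β) ≡ pairInP α β
pairInP-swapAt j (e , j₁) (e' , j₂) with j ≟ j₁ | j ≟ j₂
... | yes refl | yes refl rewrite ⌊⌋-yes (j ≟ j) refl = xor-annihilates-not e e'
... | yes refl | no j≢j₂ rewrite ⌊⌋-no (j ≟ j₂) j≢j₂ = refl
... | no j≢j₁ | yes refl rewrite ⌊⌋-no (j₁ ≟ j) (j≢j₁ ∘ sym) = refl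
... | no _ | no _ = refl

permutation-injective : ∀ {m} (π : Permutation′ m) → Injective _≡_ _≡_ (π ⟨$⟩ʳ_)
permutation-injective π = Bijection.injective (↔⇒⤖ π)

permutation-bijective : ∀ {m} (π : Permutation′ m) → Bijective _≡_ _≡_ (π ⟨$⟩ʳ_)
permutation-bijective π = Bijection.bijective (↔⇒⤖ π)

transpose-here : ∀ {m} (i j : Fin m) → transpose i j ⟨$⟩ʳ i ≡ j
transpose-here i j rewrite dec-true (i ≟ i) refl = refl

transpose-elsewhere : ∀ {m} {i j k : Fin m} → k ≢ i → k ≢ j → transpose i j ⟨$⟩ʳ k ≡ k
transpose-elsewhere {i = i} {j} {k} k≢i k≢j rewrite dec-false (k ≟ i) k≢i | dec-false (k ≟ j) k≢j = refl

Sym-2-transitive : ∀ {n} {i i' : Fin (2 + n)} → i ≢ i' →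
  Σ (Permutation′ (2 + n)) λ π → π ⟨$⟩ʳ i ≡ zero × π ⟨$⟩ʳ i' ≡ suc zero
Sym-2-transitive {i = i} {i'} i≢i' = transpose i zero ∘ₚ transpose i'' (suc zero) ,
  trans (cong (transpose i'' (suc zero) ⟨$⟩ʳ_) (transpose-here i zero)) (transpose-elsewhere 0≢i'' λ ()) ,
  transpose-here i'' (suc zero)
  where
  i'' = transpose i zero ⟨$⟩ʳ i'
  0≢i'' : zero ≢ i''
  0≢i'' 0≡i'' = i≢i' (permutation-injective (transpose i zero) (trans (transpose-here i zero) 0≡i''))

anyFin-cong : ∀ {n} {p q : Fin n → Bool} → (∀ i → p i ≡ q i) → anyFin p ≡ anyFin q
anyFin-cong {zero} _ = refl
anyFin-cong {suc n} p≗q = cong₂ _∨_ (p≗q zero) (anyFin-cong (p≗q ∘ suc))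

anyFin-const : ∀ n b → anyFin {suc n} (λ _ → b) ≡ b
anyFin-const zero b = ∨-identityʳ b
anyFin-const (suc n) b = trans (cong (b ∨_) (anyFin-const n b)) (∨-idem b)

-- Graphs satisfying the hypotheses of the theorem

module Structure (n k' : ℕ) (Γ : Graph (Vtx (2 + n) (suc k')))
  (Γ-simple : IsSimple Γ) (Γ-transitive : VertexTransitive Γ)
  (Xᵏ≤Aut : XkInAut Γ) (Aut≤Y≀Sym : AutInYwr Γ) (stabiliser≡X : StabIsX Γ zero) where

  private
    m = 2 + n
    k = suc k'

  ΓInf : Bool → Bool → Graph (Orb k × Fin m)
  ΓInf = Inf (decOrb k) (quot Γ) pairInP m

  ΓD : (j : Fin k) → Graph (Σ (Vtx m k) (InD j))
  ΓD j = induced Γ (InD j)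

  xOn-here : ∀ (j : Fin k) (σ : Fin m → Fin m) e i → xOn j σ ((e , i) , j) ≡ ((e , σ i) , j)
  xOn-here j σ e i rewrite ⌊⌋-yes (j ≟ j) refl | xor-identityʳ e = refl

  xOn-elsewhere : ∀ {j j' : Fin k} (σ : Fin m → Fin m) e i → j' ≢ j → xOn j σ ((e , i) , j') ≡ ((e , i) , j')
  xOn-elsewhere {j} {j'} σ e i j'≢j rewrite ⌊⌋-no (j' ≟ j) j'≢j = refl

  xOn-preserves : ∀ j (π : Permutation′ m) u v → Γ (xOn j (π ⟨$⟩ʳ_) u) (xOn j (π ⟨$⟩ʳ_) v) ≡ Γ u v
  xOn-preserves j π u v = trans (cong₂ Γ (xOn≗wr u) (xOn≗wr v)) (proj₂ (Xᵏ≤Aut σ σ-bijective) u v)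
    where
    σ : Fin k → Fin m → Fin m
    σ j' = if ⌊ j' ≟ j ⌋ then π ⟨$⟩ʳ_ else Perm.id ⟨$⟩ʳ_

    σ-bijective : ∀ j' → Bijective _≡_ _≡_ (σ j')
    σ-bijective j' with ⌊ j' ≟ j ⌋
    ... | true = permutation-bijective π
    ... | false = permutation-bijective Perm.id

    xOn≗wr : ∀ v → xOn j (π ⟨$⟩ʳ_) v ≡ wr (λ _ → false) σ id v
    xOn≗wr ((e , i) , j') with ⌊ j' ≟ j ⌋
    ... | true = refl
    ... | false = cong (λ e' → (e' , i) , j') (sym (xor-identityʳ e))

  relabel-within-block : ∀ (π : Permutation′ m) j e i e' i' {x x'} →
    π ⟨$⟩ʳ i ≡ x → π ⟨$⟩ʳ i' ≡ x' → Γ ((e , x) , j) ((e' , x') , j) ≡ Γ ((e , i) , j) ((e' , i') , j)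
  relabel-within-block π j e i e' i' refl refl =
    trans (sym (cong₂ Γ (xOn-here j (π ⟨$⟩ʳ_) e i) (xOn-here j (π ⟨$⟩ʳ_) e' i'))) (xOn-preserves j π _ _)

  relabel-first : ∀ (π : Permutation′ m) {j j'} e i e' i' {x} → j ≢ j' →
    π ⟨$⟩ʳ i ≡ x → Γ ((e , x) , j) ((e' , i') , j') ≡ Γ ((e , i) , j) ((e' , i') , j')
  relabel-first π {j} e i e' i' j≢j' refl =
    trans (sym (cong₂ Γ (xOn-here j (π ⟨$⟩ʳ_) e i) (xOn-elsewhere (π ⟨$⟩ʳ_) e' i' (j≢j' ∘ sym))))
          (xOn-preserves j π _ _)

  relabel-second : ∀ (π : Permutation′ m) {j j'} e i e' i' {x'} → j ≢ j' →
    π ⟨$⟩ʳ i' ≡ x' → Γ ((e , i) , j) ((e' , x') , j') ≡ Γ ((e , i) , j) ((e' , i') , j')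
  relabel-second π {j} {j'} e i e' i' j≢j' refl =
    trans (sym (cong₂ Γ (xOn-elsewhere (π ⟨$⟩ʳ_) e i j≢j') (xOn-here j' (π ⟨$⟩ʳ_) e' i')))
          (xOn-preserves j' π _ _)

  same-block-canonical : ∀ j e i e' i' → Γ ((e , i) , j) ((e' , i') , j) ≡
    Γ ((e , zero) , j) ((e' , (if ⌊ i ≟ i' ⌋ then zero else suc zero)) , j)
  same-block-canonical j e i e' i' with i ≟ i'
  ... | yes refl = sym (relabel-within-block (transpose i zero) j e i e' i (transpose-here i zero) (transpose-here i zero))
  ... | no i≢i' with Sym-2-transitive i≢i'
  ...   | π , πi≡0 , πi'≡1 = sym (relabel-within-block π j e i e' i' πi≡0 πi'≡1)

  between-blocks-canonical : ∀ {j j'} e i e' i' → j ≢ j' →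
    Γ ((e , i) , j) ((e' , i') , j') ≡ Γ ((e , zero) , j) ((e' , zero) , j')
  between-blocks-canonical {j} {j'} e i e' i' j≢j' = begin
    Γ ((e , i) , j) ((e' , i') , j')
      ≡⟨ relabel-second (transpose i' zero) e i e' i' j≢j' (transpose-here i' zero) ⟨
    Γ ((e , i) , j) ((e' , zero) , j')
      ≡⟨ relabel-first (transpose i zero) e i e' zero j≢j' (transpose-here i zero) ⟨
    Γ ((e , zero) , j) ((e' , zero) , j') ∎
    where open ≡-Reasoning

  same-block-relabel : ∀ (ρ : Fin m → Fin m) → Injective _≡_ _≡_ ρ → ρ zero ≡ zero →
    ∀ j e e' d → Γ ((e , zero) , j) ((e' , ρ d) , j) ≡ Γ ((e , zero) , j) ((e' , d) , j)
  same-block-relabel ρ ρ-injective ρ0≡0 j e e' d =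
    trans (same-block-canonical j e zero e' (ρ d))
      (trans (cong (λ b → Γ ((e , zero) , j) ((e' , (if b then zero else suc zero)) , j)) ⌊0≟ρd⌋≡⌊0≟d⌋)
             (sym (same-block-canonical j e zero e' d)))
    where
    ⌊0≟ρd⌋≡⌊0≟d⌋ : ⌊ zero ≟ ρ d ⌋ ≡ ⌊ zero ≟ d ⌋
    ⌊0≟ρd⌋≡⌊0≟d⌋ =
      trans (cong (λ z → ⌊ z ≟ ρ d ⌋) (sym ρ0≡0)) (⌊≟⌋-injective _≟_ _≟_ ρ-injective zero d)

  -- s is the sign of the second vertex relative to the first.
  vertex-profile : ∀ s ε j d →
    Γ ((ε , zero) , j) ((s xor ε , d) , j) ≡ Γ ((true , zero) , zero) ((s xor true , d) , zero)
  vertex-profile s ε j d with Γ-transitive ((true , zero) , zero) ((ε , zero) , j)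
  ... | f , f-aut , f-root with Aut≤Y≀Sym f f-aut
  ... | t , σ , h , σ-bijective , _ , f≗wr = begin
    Γ ((ε , zero) , j) ((s xor ε , d) , j)
      ≡⟨ same-block-relabel (σ zero) (proj₁ (σ-bijective zero)) σ00 j ε (s xor ε) d ⟨
    Γ ((ε , zero) , j) ((s xor ε , σ zero d) , j)               ≡⟨ cong₂ Γ f-root image ⟨
    Γ (f ((true , zero) , zero)) (f ((s xor true , d) , zero))  ≡⟨ proj₂ f-aut _ _ ⟩
    Γ ((true , zero) , zero) ((s xor true , d) , zero)          ∎
    where
    open ≡-Reasoning
    root : ((not (t zero) , σ zero zero) , h zero) ≡ ((ε , zero) , j)
    root = trans (sym (f≗wr _)) f-root
    σ00 : σ zero zero ≡ zero
    σ00 = cong (proj₂ ∘ proj₁) root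
    image : f ((s xor true , d) , zero) ≡ ((s xor ε , σ zero d) , j)
    image = trans (f≗wr _) (cong₂ (λ e j' → (e , σ zero d) , j')
      (trans (xor-assoc s true (t zero)) (cong (s xor_) (cong (proj₁ ∘ proj₁) root))) (cong proj₂ root))

  κ₀ λ₀ μ₀ : Bool
  κ₀ = Γ ((true , zero) , zero) ((true , suc zero) , zero)
  λ₀ = Γ ((true , zero) , zero) ((false , zero) , zero)
  μ₀ = Γ ((true , zero) , zero) ((false , suc zero) , zero)

  opposite-sides-constant : μ₀ ≡ λ₀ → ∀ j e i i' → Γ ((e , i) , j) ((not e , i') , j) ≡ λ₀
  opposite-sides-constant μ₀≡λ₀ j e i i' with i ≟ i' | same-block-canonical j e i (not e) i'
  ... | yes _ | canonical = trans canonical (vertex-profile true e j zero)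
  ... | no _ | canonical = trans canonical (trans (vertex-profile true e j (suc zero)) μ₀≡λ₀)

  relabelHalves : (Bool → Fin k → Permutation′ m) → Vtx m k → Vtx m k
  relabelHalves ρ ((e , i) , j) = (e , ρ e j ⟨$⟩ʳ i) , j

  relabelHalves-bijective : ∀ ρ → Bijective _≡_ _≡_ (relabelHalves ρ)
  relabelHalves-bijective ρ = inverse⇒bijective (relabelHalves (λ e j → Perm.flip (ρ e j)))
    (λ { ((e , i) , j) → cong (λ i' → (e , i') , j) (Perm.inverseʳ (ρ e j)) })
    (λ { ((e , i) , j) → cong (λ i' → (e , i') , j) (Perm.inverseˡ (ρ e j)) })

  -- If μ₀ ≡ λ₀, adjacency between the halves A_j, A_{-j} of a block ignores the indices.
  relabelHalves-preserves : μ₀ ≡ λ₀ → ∀ ρ u v → Γ (relabelHalves ρ u) (relabelHalves ρ v) ≡ Γ u v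
  relabelHalves-preserves μ₀≡λ₀ ρ ((e , i) , j) ((e' , i') , j') with j ≟ j'
  ... | no j≢j' = trans (between-blocks-canonical e _ e' _ j≢j') (sym (between-blocks-canonical e i e' i' j≢j'))
  ... | yes refl with e ≟ᵇ e'
  ...   | yes refl = begin
    Γ ((e , ρ e j ⟨$⟩ʳ i) , j) ((e , ρ e j ⟨$⟩ʳ i') , j)
      ≡⟨ same-block-canonical j e _ e _ ⟩
    Γ ((e , zero) , j) ((e , (if ⌊ ρ e j ⟨$⟩ʳ i ≟ ρ e j ⟨$⟩ʳ i' ⌋ then zero else suc zero)) , j)
      ≡⟨ cong (λ b → Γ ((e , zero) , j) ((e , (if b then zero else suc zero)) , j))
              (⌊≟⌋-injective _≟_ _≟_ (permutation-injective (ρ e j)) i i') ⟩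
    Γ ((e , zero) , j) ((e , (if ⌊ i ≟ i' ⌋ then zero else suc zero)) , j)
      ≡⟨ same-block-canonical j e i e i' ⟨
    Γ ((e , i) , j) ((e , i') , j) ∎
    where open ≡-Reasoning
  ...   | no e≢e' rewrite ¬-not (e≢e' ∘ sym) =
    trans (opposite-sides-constant μ₀≡λ₀ j e _ _) (sym (opposite-sides-constant μ₀≡λ₀ j e i i'))

  -- If μ₀ ≡ λ₀, transposing two indices in A_1 alone is an automorphism supported on D_1 that is not in X.
  μ₀≢λ₀ : μ₀ ≢ λ₀
  μ₀≢λ₀ μ₀≡λ₀ = not-in-X (proj₁ (stabiliser≡X g) (g-aut , g-fixes))
    where
    ρ : Bool → Fin k → Permutation′ m
    ρ e j = if e ∧ ⌊ j ≟ zero ⌋ then transpose zero (suc zero) else Perm.id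
    g = relabelHalves ρ
    g-aut : IsAut Γ g
    g-aut = relabelHalves-bijective ρ , relabelHalves-preserves μ₀≡λ₀ ρ
    g-fixes : ∀ v → proj₂ v ≢ zero → g v ≡ v
    g-fixes ((e , i) , j) j≢0 rewrite ⌊⌋-no (j ≟ zero) j≢0 | ∧-zeroʳ e = refl
    not-in-X : ¬ (Σ (Fin m → Fin m) λ σ → Bijective _≡_ _≡_ σ × (∀ v → g v ≡ xOn zero σ v))
    not-in-X (σ , _ , g≗xOn) = 0≢1+n (trans (sym (σ0≡ false)) (σ0≡ true))
      where
      σ0≡ : ∀ e → σ zero ≡ proj₂ (proj₁ (g ((e , zero) , zero)))
      σ0≡ e = sym (cong (proj₂ ∘ proj₁) (g≗xOn ((e , zero) , zero)))

  μ₀≡not-λ₀ : μ₀ ≡ not λ₀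
  μ₀≡not-λ₀ with μ₀ ≟ᵇ not λ₀
  ... | yes μ₀≡not-λ₀ = μ₀≡not-λ₀
  ... | no μ₀≢not-λ₀ = ⊥-elim (μ₀≢λ₀ (trans (¬-not μ₀≢not-λ₀) (not-involutive λ₀)))

  same-block-adjacency : ∀ j e i e' i' → Γ ((e , i) , j) ((e' , i') , j) ≡ Block m λ₀ κ₀ (i , side e) (i' , side e')
  same-block-adjacency j e i e' i' with i ≟ i' | same-block-canonical j e i e' i'
  same-block-adjacency j true i true i' | yes _ | canonical = trans canonical (proj₂ Γ-simple _)
  same-block-adjacency j false i false i' | yes _ | canonical = trans canonical (proj₂ Γ-simple _)
  same-block-adjacency j true i true i' | no _ | canonical = trans canonical (vertex-profile false true j (suc zero))
  same-block-adjacency j false i false i' | no _ | canonical = trans canonical (vertex-profile false false j (suc zero))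
  same-block-adjacency j true i false i' | yes _ | canonical =
    trans canonical (trans (vertex-profile true true j zero) (sym (cross-side-equal λ₀)))
  same-block-adjacency j false i true i' | yes _ | canonical =
    trans canonical (trans (vertex-profile true false j zero) (sym (cross-side-equal λ₀)))
  same-block-adjacency j true i false i' | no _ | canonical =
    trans canonical (trans (vertex-profile true true j (suc zero)) (trans μ₀≡not-λ₀ (sym (cross-side-distinct λ₀))))
  same-block-adjacency j false i true i' | no _ | canonical =
    trans canonical (trans (vertex-profile true false j (suc zero)) (trans μ₀≡not-λ₀ (sym (cross-side-distinct λ₀))))

  quot-loopless : ∀ α → quot Γ α α ≡ false
  quot-loopless α rewrite ⌊⌋-yes (decOrb k α α) refl = refl

  between-blocks-adjacency : ∀ {j j'} e i e' i' → j ≢ j' → Γ ((e , i) , j) ((e' , i') , j') ≡ quot Γ (e , j) (e' , j')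
  between-blocks-adjacency {j} {j'} e i e' i' j≢j'
    rewrite ⌊⌋-no (decOrb k (e , j) (e' , j')) (j≢j' ∘ cong proj₂) =
    trans (between-blocks-canonical e i e' i' j≢j')
          (sym (trans (anyFin-cong λ i₁ → trans (anyFin-cong λ i₂ → between-blocks-canonical e i₁ e' i₂ j≢j')
                                                (anyFin-const (suc n) representative))
                      (anyFin-const (suc n) representative)))
    where representative = Γ ((e , zero) , j) ((e' , zero) , j')

  toInf : Vtx m k → Orb k × Fin m
  toInf ((e , i) , j) = (e , j) , i

  fromInf : Orb k × Fin m → Vtx m k
  fromInf ((e , j) , i) = (e , i) , j

  Inf-toInf : ∀ u v → ΓInf λ₀ κ₀ (toInf u) (toInf v) ≡ Γ u v
  Inf-toInf ((e , i) , j) ((e' , i') , j') = by-blocks (j ≟ j')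
    where
    by-blocks : Dec (j ≡ j') → ΓInf λ₀ κ₀ ((e , j) , i) ((e' , j') , i') ≡ Γ ((e , i) , j) ((e' , i') , j')
    by-blocks (yes refl) =
      trans (Inf-within-block (quot Γ) m λ₀ κ₀ quot-loopless j e i e' i') (sym (same-block-adjacency j e i e' i'))
    by-blocks (no j≢j') =
      trans (Inf-between-blocks (quot Γ) m λ₀ κ₀ e i e' i' j≢j') (sym (between-blocks-adjacency e i e' i' j≢j'))

  Γ≅Inf : Γ ≅ ΓInf λ₀ κ₀
  Γ≅Inf = mk≅ toInf fromInf (λ _ → refl) (λ _ → refl) Inf-toInf

  block≅Block : ∀ j → ΓD j ≅ Block m λ₀ κ₀
  block≅Block j = mk≅ {A = ΓD j} {B = Block m λ₀ κ₀} to from to∘from from∘to pres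
    where
    to : Σ (Vtx m k) (InD j) → Fin m × Fin 2
    to (((e , i) , _) , _) = i , side e
    from : Fin m × Fin 2 → Σ (Vtx m k) (InD j)
    from (i , zero) = ((true , i) , j) , refl
    from (i , suc zero) = ((false , i) , j) , refl
    to∘from : ∀ x → to (from x) ≡ x
    to∘from (i , zero) = refl
    to∘from (i , suc zero) = refl
    from∘to : ∀ x → from (to x) ≡ x
    from∘to (((true , i) , _) , refl) = refl
    from∘to (((false , i) , _) , refl) = refl
    pres : ∀ u v → Block m λ₀ κ₀ (to u) (to v) ≡ ΓD j u v
    pres (((e , i) , _) , refl) (((e' , i') , _) , refl) = sym (same-block-adjacency j e i e' i')

  liftOrb : (Orb k → Orb k) → Vtx m k → Vtx m k
  liftOrb s = fromInf ∘ map₁ s ∘ toInf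

  liftOrb-preserves : ∀ (s : Orb k → Orb k) → Injective _≡_ _≡_ s →
    (∀ α β → pairInP (s α) (s β) ≡ pairInP α β) → (∀ α β → quot Γ (s α) (s β) ≡ quot Γ α β) →
    ∀ u v → Γ (liftOrb s u) (liftOrb s v) ≡ Γ u v
  liftOrb-preserves s s-injective s-pairInP s-quot u v = begin
    Γ (liftOrb s u) (liftOrb s v)
      ≡⟨ Inf-toInf (liftOrb s u) (liftOrb s v) ⟨
    ΓInf λ₀ κ₀ (map₁ s (toInf u)) (map₁ s (toInf v))
      ≡⟨ Inf-lift (decOrb k) (quot Γ) pairInP m λ₀ κ₀ s s-injective s-pairInP s-quot (toInf u) (toInf v) ⟩
    ΓInf λ₀ κ₀ (toInf u) (toInf v)
      ≡⟨ Inf-toInf u v ⟩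
    Γ u v ∎
    where open ≡-Reasoning

  -- Conjugating such an automorphism into D_1 would give an element of the stabiliser that is not in X.
  supported-automorphism-keeps-sign : ∀ j (g : Vtx m k → Vtx m k) → IsAut Γ g →
    (∀ v → proj₂ v ≢ j → g v ≡ v) → g ((true , zero) , j) ≢ ((false , zero) , j)
  supported-automorphism-keeps-sign j g g-aut g-fixes g-flips
    with Γ-transitive ((true , zero) , zero) ((true , zero) , j)
  ... | f , f-aut , f-root with Aut≤Y≀Sym f f-aut
  ... | t , σ , h , _ , h-bijective , f≗wr = not-in-X (proj₁ (stabiliser≡X F) (F-aut , F-fixes))
    where
    open Inverse (⤖⇒↔ (mk⤖ (proj₁ f-aut))) using (from; strictlyInverseˡ; strictlyInverseʳ)
    f-iso : Γ ≅ Γ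
    f-iso = f , f-aut
    F : Vtx m k → Vtx m k
    F = from ∘ g ∘ f
    F-aut : IsAut Γ F
    F-aut = proj₂ (≅-trans {A = Γ} {B = Γ} {C = Γ} f-iso
                     (≅-trans {A = Γ} {B = Γ} {C = Γ} (g , g-aut) (≅-sym {A = Γ} {B = Γ} f-iso)))
    root : ((not (t zero) , σ zero zero) , h zero) ≡ ((true , zero) , j)
    root = trans (sym (f≗wr _)) f-root
    F-fixes : ∀ v → proj₂ v ≢ zero → F v ≡ v
    F-fixes v@(_ , j') j'≢0 = trans (cong from (g-fixes (f v) fv∉Dj)) (strictlyInverseʳ v)
      where
      fv∉Dj : proj₂ (f v) ≢ j
      fv∉Dj fv∈Dj =
        j'≢0 (proj₁ h-bijective (trans (sym (cong proj₂ (f≗wr v))) (trans fv∈Dj (sym (cong proj₂ root)))))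
    not-in-X : ¬ (Σ (Fin m → Fin m) λ σ' → Bijective _≡_ _≡_ σ' × (∀ v → F v ≡ xOn zero σ' v))
    not-in-X (σ' , _ , F≗xOn) =
      not-¬ refl (trans (cong sign (sym f-w)) (trans (cong sign (f≗wr w)) (cong sign root)))
      where
      sign = proj₁ ∘ proj₁
      w = (true , σ' zero) , zero
      f-w : f w ≡ ((false , zero) , j)
      f-w = trans (cong f (sym (F≗xOn ((true , zero) , zero))))
              (trans (cong (f ∘ from ∘ g) f-root) (trans (cong (f ∘ from) g-flips) (strictlyInverseˡ _)))

  no-swap : ∀ j → ¬ (∀ a b → quot Γ (swapAt j a) (swapAt j b) ≡ quot Γ a b)
  no-swap j swap-preserves = supported-automorphism-keeps-sign j flip (flip-bijective , flip-preserves) flip-fixes flip-flips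
    where
    flip = liftOrb (swapAt j)
    flip-involutive : ∀ v → flip (flip v) ≡ v
    flip-involutive ((e , i) , j') = cong (λ α → (proj₁ α , i) , proj₂ α) (swapAt-involutive j (e , j'))
    flip-bijective : Bijective _≡_ _≡_ flip
    flip-bijective = inverse⇒bijective flip flip-involutive flip-involutive
    flip-preserves : ∀ u v → Γ (flip u) (flip v) ≡ Γ u v
    flip-preserves = liftOrb-preserves (swapAt j)
      (λ {α} {β} eq → trans (sym (swapAt-involutive j α)) (trans (cong (swapAt j) eq) (swapAt-involutive j β)))
      (pairInP-swapAt j) swap-preserves
    flip-fixes : ∀ v → proj₂ v ≢ j → flip v ≡ v
    flip-fixes (_ , j') j'≢j rewrite ⌊⌋-no (j ≟ j') (j'≢j ∘ sym) = refl
    flip-flips : flip ((true , zero) , j) ≡ ((false , zero) , j)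
    flip-flips rewrite ⌊⌋-yes (j ≟ j) refl = refl

  Γ≅Inf-from-block-type : ∀ {G : Graph (Fin m × Fin 2)} λ' κ → (∀ u v → G u v ≡ Block m λ' κ u v) →
    ΓD zero ≅ G → Γ ≅ ΓInf λ' κ
  Γ≅Inf-from-block-type {G} λ' κ G≗Block Γ₁≅G =
    ≅-trans {A = Γ} {B = ΓInf λ₀ κ₀} {C = ΓInf λ' κ} Γ≅Inf (Block-≅⇒Inf-≅ (quot Γ) n λ₀ κ₀ λ' κ
      (≅-trans {A = Block m λ₀ κ₀} {B = ΓD zero} {C = Block m λ' κ}
        (≅-sym {A = ΓD zero} {B = Block m λ₀ κ₀} (block≅Block zero))
        (≅-respʳ {A = ΓD zero} {B = G} G≗Block Γ₁≅G)))

theorem3p14 : (m k : ℕ) → 2 ≤ m → (k≥1 : 1 ≤ k) → (Γ : Graph (Vtx m k)) →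
    IsSimple Γ → VertexTransitive Γ → XkInAut Γ → AutInYwr Γ →
    StabIsX Γ (one k k≥1) →
    let Γ₁ = induced Γ (InD (one k k≥1))
        Σg = quot Γ
        ΓInf = Inf (decOrb k) Σg pairInP m
    in
    -- (1)
    ((j₁ j₂ : Fin k) →
       (induced Γ (InD j₁) ≅ induced Γ (InD j₂))
       × ((induced Γ (InD j₁) ≅ mK2 m)
          ⊎ (induced Γ (InD j₁) ≅ KmK2 m)
          ⊎ (induced Γ (InD j₁) ≅ complement (decFin2 m) (mK2 m))
          ⊎ (induced Γ (InD j₁) ≅ complement (decFin2 m) (KmK2 m))))
    -- (2)
    × ((Γ₁ ≅ mK2 m → Γ ≅ ΓInf true false)
       × (Γ₁ ≅ KmK2 m → Γ ≅ ΓInf true true)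
       × (Γ₁ ≅ complement (decFin2 m) (mK2 m) → Γ ≅ ΓInf false true)
       × (Γ₁ ≅ complement (decFin2 m) (KmK2 m) → Γ ≅ ΓInf false false))
    -- (3)
    × ((j : Fin k) → ¬ (∀ a b → Σg (swapAt j a) (swapAt j b) ≡ Σg a b))
theorem3p14 (suc (suc n)) (suc k') (s≤s (s≤s z≤n)) (s≤s z≤n) Γ simple transitive Xᵏ≤Aut Aut≤Y≀Sym stab =
  (λ j₁ j₂ → ≅-trans {A = ΓD j₁} {B = Block m λ₀ κ₀} {C = ΓD j₂} (block≅Block j₁)
                (≅-sym {A = ΓD j₂} {B = Block m λ₀ κ₀} (block≅Block j₂)) ,
             Block-classification m λ₀ κ₀ (block≅Block j₁)) ,
  (Γ≅Inf-from-block-type true false (Block-mK2 m) ,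
   Γ≅Inf-from-block-type true true (Block-KmK2 m) ,
   Γ≅Inf-from-block-type false true (Block-co-mK2 m) ,
   Γ≅Inf-from-block-type false false (Block-co-KmK2 m)) ,
  no-swap
  where
  m = suc (suc n)
  open Structure n k' Γ simple transitive Xᵏ≤Aut Aut≤Y≀Sym stab
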